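{- Let $G=(A\,\dot\cup\,B,E)$ be a bipartite graph with $A=\{a_1,\dots,a_n\}$, $B=\{b_1,\dots,b_n\}$, let $k\ge1$, and let $OPT$ be a consecutive matching of $G$ of maximum cardinality. Run the procedure $\textsc{Greedy}(k)$ on $G$, and let $s_1,\dots,s_m$ be the streaks it adds to its solution, in order. For $i=1,\dots,m$ let $o_i$ be the set of edges of $OPT$ that overlap with $s_i$ but do not overlap with any of $s_1,\dots,s_{i-1}$. Then $|o_i|\le 2|s_i|+2$ for every $i$.
   Context: A matching $M\subseteq E$ is consecutive if whenever $(a_i,b_j),(a_{i+1},b_{j'})\in M$ then $j'=j+1$, and whenever $(a_i,b_j),(a_{i'},b_{j+1})\in M$ then $i'=i+1$. Two edges $(a_i,b_j)$ and $(a_{i'},b_{j'})$ overlap if $|i-i'|\le1$ or $|j-j'|\le1$ (in particular every edge overlaps with itself); two sets of edges overlap if some edge of the first overlaps some edge of the second, and similarly for an edge and a set. For a set $F$ of edges (a graph's edge set or a consecutive matching), a streak of $F$ is a maximal (under inclusion) set of edges $e_1,\dots,e_r\in F$ such that for some $p,q$, $e_l=(a_{p+l},b_{q+l})$ for all $l=1,\dots,r$; its size is $r$. Procedure $\textsc{Greedy}(k)$: start with $ALG=\emptyset$; repeat: let $s$ be a largest streak of the current graph (ties broken arbitrarily); if $|s|<k$ stop; otherwise remove from the current graph $s$ and all edges overlapping with $s$, and set $ALG:=ALG\cup s$. It returns $ALG$. -}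

module Defs where

open import Data.Bool using (Bool; true; false; _∧_; _∨_; not; if_then_else_)
open import Data.Nat using (ℕ; zero; suc; _+_; _*_; _≤_; _<_; _≤ᵇ_; ∣_-_∣)
open import Data.Fin using (Fin; toℕ)
open import Data.List using (List; []; _∷_; _++_; map; allFin; upTo)
open import Data.Nat.ListAction using (sum)
open import Data.Bool.ListAction using (any)
open import Data.Product using (Σ; _×_; _,_)
open import Relation.Binary.PropositionalEquality using (_≡_)

-- Vertices a_1..a_n and b_1..b_n are represented (0-indexed) by Fin n.
-- An edge set is a Boolean predicate on A × B; (a_i , b_j) ∈ F  iff  F i j ≡ true.
EdgeSet : ℕ → Set
EdgeSet n = Fin n → Fin n → Bool

_∈E_ : ∀ {n} → Fin n × Fin n → EdgeSet n → Set
(i , j) ∈E F = F i j ≡ true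

card : ∀ {n} → EdgeSet n → ℕ
card {n} F = sum (map (λ i → sum (map (λ j → if F i j then 1 else 0) (allFin n))) (allFin n))

_⊆E_ : ∀ {n} → EdgeSet n → EdgeSet n → Set
M ⊆E F = ∀ i j → M i j ≡ true → F i j ≡ true

IsMatching : ∀ {n} → EdgeSet n → Set
IsMatching M = ∀ i j i' j' → M i j ≡ true → M i' j' ≡ true →
  (i ≡ i' → j ≡ j') × (j ≡ j' → i ≡ i')

IsConsecutive : ∀ {n} → EdgeSet n → Set
IsConsecutive M = ∀ i j i' j' → M i j ≡ true → M i' j' ≡ true →
  (toℕ i' ≡ suc (toℕ i) → toℕ j' ≡ suc (toℕ j)) ×
  (toℕ j' ≡ suc (toℕ j) → toℕ i' ≡ suc (toℕ i))

IsConsecutiveMatching : ∀ {n} → EdgeSet n → EdgeSet n → Set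
IsConsecutiveMatching E M = (M ⊆E E) × IsMatching M × IsConsecutive M

IsMaxConsecutiveMatching : ∀ {n} → EdgeSet n → EdgeSet n → Set
IsMaxConsecutiveMatching E M =
  IsConsecutiveMatching E M × (∀ M' → IsConsecutiveMatching E M' → card M' ≤ card M)

-- A diagonal run: the edge set { (a_{p+l}, b_{q+l}) : l < r }  (0-indexed), of size r.
record Run : Set where
  constructor run
  field
    p q r : ℕ
open Run public

InRun : ∀ {n} → Run → Fin n → Fin n → Set
InRun s i j = Σ ℕ λ l → l < r s × toℕ i ≡ p s + l × toℕ j ≡ q s + l

IsRunOf : ∀ {n} → EdgeSet n → Run → Set
IsRunOf {n} F s =
  (∀ l → l < r s → (p s + l < n) × (q s + l < n)) ×
  (∀ i j → InRun s i j → F i j ≡ true)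

IsStreak : ∀ {n} → EdgeSet n → Run → Set
IsStreak {n} F s =
  IsRunOf F s ×
  (∀ t → IsRunOf F t →
     (∀ (i j : Fin n) → InRun s i j → InRun t i j) →
     (∀ (i j : Fin n) → InRun t i j → InRun s i j))

overlapᵇ : ℕ → ℕ → ℕ → ℕ → Bool
overlapᵇ i j i' j' = (∣ i - i' ∣ ≤ᵇ 1) ∨ (∣ j - j' ∣ ≤ᵇ 1)

overlapsRunᵇ : ∀ {n} → Run → Fin n → Fin n → Bool
overlapsRunᵇ s i j = any (λ l → overlapᵇ (toℕ i) (toℕ j) (p s + l) (q s + l)) (upTo (r s))

overlapsSomeᵇ : ∀ {n} → List Run → Fin n → Fin n → Bool
overlapsSomeᵇ ss i j = any (λ s → overlapsRunᵇ s i j) ss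

-- remove s and all edges overlapping s (s itself overlaps itself)
removeOverlapping : ∀ {n} → EdgeSet n → Run → EdgeSet n
removeOverlapping F s i j = F i j ∧ not (overlapsRunᵇ s i j)

-- GreedyRun k C ss : ss is the sequence of streaks added by some execution
-- of Greedy(k) (with some tie-breaking) started on the current graph C.
data GreedyRun {n : ℕ} (k : ℕ) : EdgeSet n → List Run → Set where
  stop : ∀ {C} →
    (∀ t → IsStreak C t → r t < k) →
    GreedyRun k C []
  step : ∀ {C s ss} →
    IsStreak C s →
    (∀ t → IsStreak C t → r t ≤ r s) →
    k ≤ r s →
    GreedyRun k (removeOverlapping C s) ss →
    GreedyRun k C (s ∷ ss)

newlyOverlapped : ∀ {n} → EdgeSet n → List Run → Run → EdgeSet n
newlyOverlapped OPT earlier s i j =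
  OPT i j ∧ overlapsRunᵇ s i j ∧ not (overlapsSomeᵇ earlier i j)

-- Let C be the graph at the moment Greedy(k) picks s. No edge of o_i overlaps an earlier streak, so
-- o_i ⊆ C, and s is a longest streak of C, so every diagonal run of C has length at most |s|.
-- An edge overlapping s lies in one of the |s| + 2 rows or one of the |s| + 2 columns around s.
-- The edges of o_i of the first kind form a consecutive matching confined to |s| + 2 rows: if it had
-- an edge in each of them, consecutiveness would line these edges up into a diagonal run of C of
-- length |s| + 2. So there are at most |s| + 1 of them, and symmetrically for columns.
module Submission where

open import Data.Bool using (Bool; true; false; _∧_; not; if_then_else_)
import Data.Bool.Properties as Bool
open import Data.Bool.Properties using (T-≡; T-∨; ∧-conicalˡ; ∧-conicalʳ; ∨-conicalˡ; ∨-conicalʳ; not-involutive; ¬-not)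
open import Data.Empty using (⊥-elim)
open import Data.Fin using (Fin; toℕ; fromℕ<; zero; suc)
import Data.Fin.Properties as Fin
open import Data.List using (List; []; _∷_; _++_)
import Data.List as List
open import Data.List.Properties using (map-tabulate)
open import Data.List.Relation.Unary.Any.Properties using (any⁻; applyUpTo⁻)
open import Data.Nat
  using (ℕ; zero; suc; _+_; _*_; _∸_; _≤_; _<_; _≤?_; _<?_; _≟_; z≤n; s≤s; s≤s⁻¹; s<s⁻¹; z<s; _≤ᵇ_; ∣_-_∣)
import Data.Nat.ListAction as ListAction
open import Data.Nat.Properties
open import Algebra.Properties.CommutativeMonoid.Sum +-0-commutativeMonoid
  using (sum; sum-syntax; sum-cong-≗; sum-replicate-zero; ∑-distrib-+; ∑-comm)
open import Data.Nat.Tactic.RingSolver using (solve-∀)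
open import Data.Product using (Σ; _×_; _,_; proj₁; proj₂)
open import Data.Sum using (_⊎_; inj₁; inj₂)
open import Function using (id; _∘_; Equivalence)
open import Relation.Binary.PropositionalEquality
  using (_≡_; _≢_; refl; sym; trans; cong; cong₂; subst; subst₂; module ≡-Reasoning)
open import Relation.Nullary using (¬_; Dec; yes; no)
open import Relation.Nullary.Decidable using (_×-dec_; ⌊_⌋; map′; toWitness; toWitnessFalse; decidable-stable)

open import Defs

open Equivalence using (to; from)

sum-map-allFin : ∀ {n} (f : Fin n → ℕ) → ListAction.sum (List.map f (List.allFin n)) ≡ sum f
sum-map-allFin f = trans (cong ListAction.sum (map-tabulate id f)) (sum-tabulate f)
  where
  sum-tabulate : ∀ {n} (f : Fin n → ℕ) → ListAction.sum (List.tabulate f) ≡ sum f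
  sum-tabulate {zero}  f = refl
  sum-tabulate {suc n} f = cong (f zero +_) (sum-tabulate (f ∘ suc))

indicator : Bool → ℕ
indicator b = if b then 1 else 0

count : ∀ {n} → (Fin n → Bool) → ℕ
count {n} f = ∑[ j < n ] indicator (f j)

count-false : ∀ {n} (f : Fin n → Bool) → (∀ j → f j ≡ false) → count f ≡ 0
count-false {n} f f≡false = trans (sum-cong-≗ (cong indicator ∘ f≡false)) (sum-replicate-zero n)

count≤1 : ∀ {n} (f : Fin n → Bool) → (∀ {j j'} → f j ≡ true → f j' ≡ true → j ≡ j') → count f ≤ 1
count≤1 {zero}  f unique = z≤n
count≤1 {suc n} f unique with f zero in f₀
... | true  = ≤-reflexive (cong suc (count-false (f ∘ suc) (λ j → ¬-not (Fin.0≢1+n ∘ unique f₀))))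
... | false = count≤1 (f ∘ suc) (λ e e' → Fin.suc-injective (unique e e'))

count≢0⇒true : ∀ {n} (f : Fin n → Bool) → count f ≢ 0 → Σ (Fin n) λ j → f j ≡ true
count≢0⇒true {zero}  f count≢0 = ⊥-elim (count≢0 refl)
count≢0⇒true {suc n} f count≢0 with f zero in f₀
... | true  = zero , f₀
... | false with count≢0⇒true (f ∘ suc) count≢0
...   | j , fj = suc j , fj

infix 30 _ᵀ

_ᵀ : ∀ {n} → EdgeSet n → EdgeSet n
(F ᵀ) i j = F j i

rowCount : ∀ {n} → EdgeSet n → Fin n → ℕ
rowCount F i = count (F i)

card≡∑rowCount : ∀ {n} (F : EdgeSet n) → card F ≡ ∑[ i < n ] rowCount F i
card≡∑rowCount {n} F =
  trans (sum-map-allFin (λ i → ListAction.sum (List.map (indicator ∘ F i) (List.allFin n))))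
        (sum-cong-≗ (λ i → sum-map-allFin (indicator ∘ F i)))

card-split : ∀ {n} (F G : EdgeSet n) →
  card F ≡ card (λ i j → F i j ∧ G i j) + card (λ i j → F i j ∧ not (G i j))
card-split {n} F G = begin
  card F
    ≡⟨ card≡∑rowCount F ⟩
  ∑[ i < n ] ∑[ j < n ] indicator (F i j)
    ≡⟨ sum-cong-≗ (λ i → sum-cong-≗ (λ j → indicator-split (F i j) (G i j))) ⟩
  ∑[ i < n ] ∑[ j < n ] (indicator (F∧G i j) + indicator (F∧¬G i j))
    ≡⟨ sum-cong-≗ (λ i → ∑-distrib-+ (indicator ∘ F∧G i) (indicator ∘ F∧¬G i)) ⟩
  ∑[ i < n ] (rowCount F∧G i + rowCount F∧¬G i)
    ≡⟨ ∑-distrib-+ (rowCount F∧G) (rowCount F∧¬G) ⟩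
  ∑[ i < n ] rowCount F∧G i + ∑[ i < n ] rowCount F∧¬G i
    ≡⟨ sym (cong₂ _+_ (card≡∑rowCount F∧G) (card≡∑rowCount F∧¬G)) ⟩
  card F∧G + card F∧¬G ∎
  where
  open ≡-Reasoning
  F∧G F∧¬G : EdgeSet n
  F∧G i j = F i j ∧ G i j
  F∧¬G i j = F i j ∧ not (G i j)
  indicator-split : ∀ b c → indicator b ≡ indicator (b ∧ c) + indicator (b ∧ not c)
  indicator-split false c     = refl
  indicator-split true  true  = refl
  indicator-split true  false = refl

card-ᵀ : ∀ {n} (F : EdgeSet n) → card (F ᵀ) ≡ card F
card-ᵀ F = trans (card≡∑rowCount (F ᵀ))
  (trans (∑-comm (λ i j → indicator (F j i))) (sym (card≡∑rowCount F)))

⊆E-trans : ∀ {n} {F G H : EdgeSet n} → F ⊆E G → G ⊆E H → F ⊆E H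
⊆E-trans F⊆G G⊆H i j = G⊆H i j ∘ F⊆G i j

⊆E-ᵀ : ∀ {n} {F G : EdgeSet n} → F ⊆E G → F ᵀ ⊆E G ᵀ
⊆E-ᵀ F⊆G i j = F⊆G j i

RowUnique : ∀ {n} → EdgeSet n → Set
RowUnique F = ∀ {i j j'} → F i j ≡ true → F i j' ≡ true → j ≡ j'

RowConsecutive : ∀ {n} → EdgeSet n → Set
RowConsecutive F = ∀ {i j i' j'} → F i j ≡ true → F i' j' ≡ true →
  toℕ i' ≡ suc (toℕ i) → toℕ j' ≡ suc (toℕ j)

RowUnique-⊆ : ∀ {n} {N M : EdgeSet n} → N ⊆E M → RowUnique M → RowUnique N
RowUnique-⊆ N⊆M unique e e' = unique (N⊆M _ _ e) (N⊆M _ _ e')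

RowConsecutive-⊆ : ∀ {n} {N M : EdgeSet n} → N ⊆E M → RowConsecutive M → RowConsecutive N
RowConsecutive-⊆ N⊆M consecutive e e' = consecutive (N⊆M _ _ e) (N⊆M _ _ e')

isMatching⇒rowUnique : ∀ {n} {M : EdgeSet n} → IsMatching M → RowUnique M × RowUnique (M ᵀ)
isMatching⇒rowUnique matching =
  (λ e e' → proj₁ (matching _ _ _ _ e e') refl) , (λ e e' → proj₂ (matching _ _ _ _ e e') refl)

isConsecutive⇒rowConsecutive : ∀ {n} {M : EdgeSet n} →
  IsConsecutive M → RowConsecutive M × RowConsecutive (M ᵀ)
isConsecutive⇒rowConsecutive consecutive =
  (λ e e' → proj₁ (consecutive _ _ _ _ e e')) , (λ e e' → proj₂ (consecutive _ _ _ _ e e'))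

InWindow : ℕ → ℕ → ℕ → Set
InWindow a m x = a ≤ x × x < a + m

inWindow? : ∀ a m x → Dec (InWindow a m x)
inWindow? a m x = a ≤? x ×-dec x <? a + m

SupportedIn : ∀ {n} → ℕ → ℕ → (Fin n → ℕ) → Set
SupportedIn a m w = ∀ i → w i ≢ 0 → InWindow a m (toℕ i)

outside⇒0 : ∀ {n a m} {w : Fin n → ℕ} → SupportedIn a m w → ∀ i → ¬ InWindow a m (toℕ i) → w i ≡ 0
outside⇒0 {w = w} supported i outside = decidable-stable (w i ≟ 0) (outside ∘ supported i)

supported-shift : ∀ {n a m} {w : Fin (suc n) → ℕ} → SupportedIn (suc a) m w → SupportedIn a m (w ∘ suc)
supported-shift supported i w≢0 = let (lo , hi) = supported (suc i) w≢0 in s≤s⁻¹ lo , s<s⁻¹ hi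

supported-tail : ∀ {n m} {w : Fin (suc n) → ℕ} → SupportedIn zero (suc m) w → SupportedIn zero m (w ∘ suc)
supported-tail supported i w≢0 = z≤n , s<s⁻¹ (proj₂ (supported (suc i) w≢0))

∑-supported-≤ : ∀ {n} a m (w : Fin n → ℕ) → (∀ i → w i ≤ 1) → SupportedIn a m w → sum w ≤ m
∑-supported-≤ {zero}  a       m       w w≤1 supported = z≤n
∑-supported-≤ {suc n} (suc a) m       w w≤1 supported
  rewrite outside⇒0 supported zero (λ { (() , _) }) =
  ∑-supported-≤ a m (w ∘ suc) (w≤1 ∘ suc) (supported-shift supported)
∑-supported-≤ {suc n} zero    zero    w w≤1 supported
  rewrite outside⇒0 supported zero (λ { (_ , ()) }) =
  ∑-supported-≤ zero zero (w ∘ suc) (w≤1 ∘ suc)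
    (λ i w≢0 → ⊥-elim (n≮0 (proj₂ (supported (suc i) w≢0))))
∑-supported-≤ {suc n} zero    (suc m) w w≤1 supported =
  +-mono-≤ (w≤1 zero) (∑-supported-≤ zero m (w ∘ suc) (w≤1 ∘ suc) (supported-tail supported))

∑-supported-covers : ∀ {n} a m (w : Fin n → ℕ) → (∀ i → w i ≤ 1) → SupportedIn a m w →
  m ≤ sum w → ∀ {l} → l < m → Σ (Fin n) λ i → toℕ i ≡ a + l × w i ≢ 0
∑-supported-covers {zero}  a       m       w w≤1 supported m≤∑ l<m = ⊥-elim (n≮0 (<-≤-trans l<m m≤∑))
∑-supported-covers {suc n} (suc a) m       w w≤1 supported m≤∑ l<m
  with ∑-supported-covers a m (w ∘ suc) (w≤1 ∘ suc) (supported-shift supported)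
         (subst (λ w₀ → m ≤ w₀ + sum (w ∘ suc)) (outside⇒0 supported zero (λ { (() , _) })) m≤∑) l<m
... | i , i≡ , w≢0 = suc i , cong suc i≡ , w≢0
∑-supported-covers {suc n} zero    zero    w w≤1 supported m≤∑ ()
∑-supported-covers {suc n} zero    (suc m) w w≤1 supported m≤∑ {zero} l<m =
  zero , refl , λ w₀≡0 → 1+n≰n (≤-trans (subst (λ w₀ → suc m ≤ w₀ + sum (w ∘ suc)) w₀≡0 m≤∑) tail≤m)
  where
  tail≤m : sum (w ∘ suc) ≤ m
  tail≤m = ∑-supported-≤ zero m (w ∘ suc) (w≤1 ∘ suc) (supported-tail supported)
∑-supported-covers {suc n} zero    (suc m) w w≤1 supported m≤∑ {suc l} l<m
  with ∑-supported-covers zero m (w ∘ suc) (w≤1 ∘ suc) (supported-tail supported)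
         (s≤s⁻¹ (≤-trans m≤∑ (+-monoˡ-≤ (sum (w ∘ suc)) (w≤1 zero)))) (s<s⁻¹ l<m)
... | i , i≡ , w≢0 = suc i , cong suc i≡ , w≢0

HasEdge : ∀ {n} → EdgeSet n → ℕ → ℕ → Set
HasEdge {n} F x y = Σ (Fin n) λ i → Σ (Fin n) λ j → toℕ i ≡ x × toℕ j ≡ y × F i j ≡ true

hasEdge? : ∀ {n} (F : EdgeSet n) x y → Dec (HasEdge F x y)
hasEdge? {n} F x y with x <? n | y <? n
... | no x≮n | _      = no λ (i , _ , i≡x , _) → x≮n (subst (_< n) i≡x (Fin.toℕ<n i))
... | yes _  | no y≮n = no λ (_ , j , _ , j≡y , _) → y≮n (subst (_< n) j≡y (Fin.toℕ<n j))
... | yes x<n | yes y<n = map′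
  (λ Fxy → fromℕ< x<n , fromℕ< y<n , Fin.toℕ-fromℕ< x<n , Fin.toℕ-fromℕ< y<n , Fxy)
  (λ (i , j , i≡x , j≡y , Fij) →
    subst₂ (λ a b → F a b ≡ true) (Fin.toℕ-injective (trans i≡x (sym (Fin.toℕ-fromℕ< x<n))))
                                  (Fin.toℕ-injective (trans j≡y (sym (Fin.toℕ-fromℕ< y<n)))) Fij)
  (F (fromℕ< x<n) (fromℕ< y<n) Bool.≟ true)

HasEdge-⊆ : ∀ {n} {N C : EdgeSet n} {x y} → N ⊆E C → HasEdge N x y → HasEdge C x y
HasEdge-⊆ N⊆C (i , j , i≡x , j≡y , Nij) = i , j , i≡x , j≡y , N⊆C i j Nij

HasEdge-ᵀ : ∀ {n} {F : EdgeSet n} {x y} → HasEdge (F ᵀ) x y → HasEdge F y x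
HasEdge-ᵀ (i , j , i≡x , j≡y , Fji) = j , i , j≡y , i≡x , Fji

DiagonalIn : ∀ {n} → EdgeSet n → Run → Set
DiagonalIn F t = ∀ {l} → l < r t → HasEdge F (p t + l) (q t + l)

diagonal⇒isRunOf : ∀ {n} {F : EdgeSet n} {t} → DiagonalIn F t → IsRunOf F t
diagonal⇒isRunOf {n} {F} diagonal =
  (λ l l<r → let (i , j , i≡ , j≡ , _) = diagonal l<r in
               subst (_< n) i≡ (Fin.toℕ<n i) , subst (_< n) j≡ (Fin.toℕ<n j)) ,
  (λ i j (l , l<r , i≡ , j≡) → let (i' , j' , i'≡ , j'≡ , Fi'j') = diagonal l<r in
    subst₂ (λ a b → F a b ≡ true) (Fin.toℕ-injective (trans i'≡ (sym i≡)))
                                  (Fin.toℕ-injective (trans j'≡ (sym j≡))) Fi'j')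

isRunOf⇒diagonal : ∀ {n} {F : EdgeSet n} {t} → IsRunOf F t → DiagonalIn F t
isRunOf⇒diagonal (inRange , inF) {l} l<r =
  let (x<n , y<n) = inRange l l<r in
  fromℕ< x<n , fromℕ< y<n , Fin.toℕ-fromℕ< x<n , Fin.toℕ-fromℕ< y<n ,
  inF _ _ (l , l<r , Fin.toℕ-fromℕ< x<n , Fin.toℕ-fromℕ< y<n)

isRunOf-ᵀ : ∀ {n} {C : EdgeSet n} {t} → IsRunOf (C ᵀ) t → IsRunOf C (run (q t) (p t) (r t))
isRunOf-ᵀ t-run = diagonal⇒isRunOf (HasEdge-ᵀ ∘ isRunOf⇒diagonal t-run)

module _ {n : ℕ} {C : EdgeSet n} where

  BlockedBefore : Run → Set
  BlockedBefore u = ∀ {x y} → suc x ≡ p u → suc y ≡ q u → ¬ HasEdge C x y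

  BlockedAfter : Run → Set
  BlockedAfter u = ¬ HasEdge C (p u + r u) (q u + r u)

  diagonal-cons : ∀ {a b c} → HasEdge C a b → DiagonalIn C (run (suc a) (suc b) c) →
    DiagonalIn C (run a b (suc c))
  diagonal-cons {a} {b} e diagonal {zero}  _   =
    subst₂ (HasEdge C) (sym (+-identityʳ a)) (sym (+-identityʳ b)) e
  diagonal-cons {a} {b} e diagonal {suc l} l<r =
    subst₂ (HasEdge C) (sym (+-suc a l)) (sym (+-suc b l)) (diagonal (s<s⁻¹ l<r))

  diagonal-snoc : ∀ {a b c} → DiagonalIn C (run a b c) → HasEdge C (a + c) (b + c) →
    DiagonalIn C (run a b (suc c))
  diagonal-snoc diagonal e l<r with m<1+n⇒m<n∨m≡n l<r
  ... | inj₁ l<c  = diagonal l<c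
  ... | inj₂ refl = e

  extend-backward : ∀ a b c → DiagonalIn C (run a b c) →
    Σ Run λ u → DiagonalIn C u × c ≤ r u × BlockedBefore u
  extend-backward zero    b       c diagonal = run zero b c , diagonal , ≤-refl , λ ()
  extend-backward (suc a) zero    c diagonal = run (suc a) zero c , diagonal , ≤-refl , λ _ ()
  extend-backward (suc a) (suc b) c diagonal with hasEdge? C a b
  ... | no ¬e = run (suc a) (suc b) c , diagonal , ≤-refl , λ { refl refl → ¬e }
  ... | yes e with extend-backward a b (suc c) (diagonal-cons e diagonal)
  ...   | u , u-diagonal , 1+c≤r , before = u , u-diagonal , ≤-trans (n≤1+n c) 1+c≤r , before

  -- The fuel bounds the distance to the last row n, beyond which no edge exists.
  extend-forward : ∀ fuel a b c → n ≤ a + c + fuel → DiagonalIn C (run a b c) →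
    Σ ℕ λ c' → c ≤ c' × DiagonalIn C (run a b c') × BlockedAfter (run a b c')
  extend-forward zero a b c n≤ diagonal =
    c , ≤-refl , diagonal ,
    λ (i , _ , i≡ , _) → <⇒≱ (subst (_< n) i≡ (Fin.toℕ<n i)) (subst (n ≤_) (+-identityʳ (a + c)) n≤)
  extend-forward (suc fuel) a b c n≤ diagonal with hasEdge? C (a + c) (b + c)
  ... | no ¬e = c , ≤-refl , diagonal , ¬e
  ... | yes e with extend-forward fuel a b (suc c) (subst (n ≤_) shift n≤) (diagonal-snoc diagonal e)
    where
    shift : a + c + suc fuel ≡ a + suc c + fuel
    shift = trans (+-suc (a + c) fuel) (cong (_+ fuel) (sym (+-suc a c)))
  ...   | c' , 1+c≤c' , diagonal' , after = c' , ≤-trans (n≤1+n c) 1+c≤c' , diagonal' , after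

  blocked⇒isStreak : ∀ {u} → DiagonalIn C u → 0 < r u → BlockedBefore u → BlockedAfter u → IsStreak C u
  blocked⇒isStreak {u} diagonal r>0 before after = diagonal⇒isRunOf diagonal , maximal
    where
    -- A run t ⊇ u starts where u starts (or it has an edge just before u) and ends where u ends.
    maximal : ∀ t → IsRunOf C t → (∀ i j → InRun u i j → InRun t i j) → ∀ i j → InRun t i j → InRun u i j
    maximal t t-run u⊆t i j (l , l<rt , i≡ , j≡) =
      l , l<ru , trans i≡ (cong (_+ l) pt≡pu) , trans j≡ (cong (_+ l) qt≡qu)
      where
      t-diagonal : DiagonalIn C t
      t-diagonal = isRunOf⇒diagonal t-run
      start : Σ ℕ λ l₀ → l₀ < r t × p t + l₀ ≡ p u × q t + l₀ ≡ q u
      start with diagonal r>0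
      ... | i₀ , j₀ , i₀≡ , j₀≡ , _ with u⊆t i₀ j₀ (0 , r>0 , i₀≡ , j₀≡)
      ...   | l₀ , l₀<r , i₀≡' , j₀≡' =
        l₀ , l₀<r , trans (sym i₀≡') (trans i₀≡ (+-identityʳ (p u))) ,
                    trans (sym j₀≡') (trans j₀≡ (+-identityʳ (q u)))
      same-start : p t ≡ p u × q t ≡ q u
      same-start with start
      ... | zero   , _      , p≡ , q≡ =
        trans (sym (+-identityʳ (p t))) p≡ , trans (sym (+-identityʳ (q t))) q≡
      ... | suc l₁ , l₀<r , p≡ , q≡ =
        ⊥-elim (before (trans (sym (+-suc (p t) l₁)) p≡) (trans (sym (+-suc (q t) l₁)) q≡)
                       (t-diagonal (<-trans (n<1+n l₁) l₀<r)))
      pt≡pu : p t ≡ p u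
      pt≡pu = proj₁ same-start
      qt≡qu : q t ≡ q u
      qt≡qu = proj₂ same-start
      l<ru : l < r u
      l<ru with l <? r u
      ... | yes l<r = l<r
      ... | no l≮r = ⊥-elim (after (subst₂ (HasEdge C) (cong (_+ r u) pt≡pu) (cong (_+ r u) qt≡qu)
                                     (t-diagonal (≤-<-trans (≮⇒≥ l≮r) l<rt))))

  run⇒longer-streak : ∀ t → IsRunOf C t → 0 < r t → Σ Run λ u → IsStreak C u × r t ≤ r u
  run⇒longer-streak (run a b c) t-run c>0 with extend-backward a b c (isRunOf⇒diagonal t-run)
  ... | run a' b' c' , diagonal , c≤c' , before with extend-forward n a' b' c' (m≤n+m n (a' + c')) diagonal
  ...   | c'' , c'≤c'' , diagonal' , after =
    run a' b' c'' , blocked⇒isStreak diagonal' (<-≤-trans c>0 c≤c'') before after , c≤c''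
    where
    c≤c'' : c ≤ c''
    c≤c'' = ≤-trans c≤c' c'≤c''

  run-≤-longest-streak : ∀ {R} → (∀ u → IsStreak C u → r u ≤ R) → ∀ t → IsRunOf C t → r t ≤ R
  run-≤-longest-streak longest (run a b zero)    t-run = z≤n
  run-≤-longest-streak longest (run a b (suc c)) t-run with run⇒longer-streak (run a b (suc c)) t-run z<s
  ... | u , u-streak , c<ru = ≤-trans c<ru (longest u u-streak)

covered⇒diagonal : ∀ {n} {N : EdgeSet n} a m → RowConsecutive N →
  (∀ {l} → l < m → Σ (Fin n) λ i → Σ (Fin n) λ j → toℕ i ≡ a + l × N i j ≡ true) →
  Σ ℕ λ b → DiagonalIn N (run a b m)
covered⇒diagonal a zero    consecutive covered = 0 , λ ()
covered⇒diagonal {N = N} a (suc m) consecutive covered = b , diagonal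
  where
  b : ℕ
  b = toℕ (proj₁ (proj₂ (covered z<s)))
  diagonal : DiagonalIn N (run a b (suc m))
  diagonal {zero} z<s =
    let (i , j , i≡ , Nij) = covered z<s in i , j , i≡ , sym (+-identityʳ b) , Nij
  diagonal {suc l} l<m =
    let (i , j , i≡ , j≡ , Nij) = diagonal {l} (<-trans (n<1+n l) l<m)
        (i' , j' , i'≡ , Ni'j') = covered l<m
    in i' , j' , i'≡ ,
       trans (consecutive Nij Ni'j' (trans i'≡ (trans (+-suc a l) (cong suc (sym i≡)))))
             (trans (cong suc j≡) (sym (+-suc b l))) ,
       Ni'j'

-- If card N = m, every row of the window carries an edge of N, and consecutiveness lines these
-- edges up into a diagonal run of length m in C.
confined-card< : ∀ {n} {C N : EdgeSet n} a m → N ⊆E C → RowUnique N → RowConsecutive N →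
  (∀ {i j} → N i j ≡ true → InWindow a m (toℕ i)) →
  (∀ t → IsRunOf C t → r t < m) →
  card N < m
confined-card< {n} {C} {N} a m N⊆C unique consecutive confined short = ≤∧≢⇒< card≤m card≢m
  where
  w≤1 : ∀ i → rowCount N i ≤ 1
  w≤1 i = count≤1 (N i) unique
  supported : SupportedIn a m (rowCount N)
  supported i w≢0 = confined (proj₂ (count≢0⇒true (N i) w≢0))
  card≤m : card N ≤ m
  card≤m = subst (_≤ m) (sym (card≡∑rowCount N)) (∑-supported-≤ a m (rowCount N) w≤1 supported)
  card≢m : card N ≢ m
  card≢m card≡m = <-irrefl refl (short (run a b m) (diagonal⇒isRunOf (HasEdge-⊆ N⊆C ∘ diagonal)))
    where
    m≤∑ : m ≤ sum (rowCount N)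
    m≤∑ = ≤-reflexive (trans (sym card≡m) (card≡∑rowCount N))
    covered : ∀ {l} → l < m → Σ (Fin n) λ i → Σ (Fin n) λ j → toℕ i ≡ a + l × N i j ≡ true
    covered l<m =
      let (i , i≡ , w≢0) = ∑-supported-covers a m (rowCount N) w≤1 supported m≤∑ l<m
          (j , Nij) = count≢0⇒true (N i) w≢0
      in i , j , i≡ , Nij
    b : ℕ
    b = proj₁ (covered⇒diagonal a m consecutive covered)
    diagonal : DiagonalIn N (run a b m)
    diagonal = proj₂ (covered⇒diagonal a m consecutive covered)

module _ {n} {C M N : EdgeSet n} (matching : IsMatching M) (consecutive : IsConsecutive M)
         (N⊆M : N ⊆E M) (N⊆C : N ⊆E C) {m} (short : ∀ t → IsRunOf C t → r t < m) where

  rowConfined-card< : ∀ a → (∀ {i j} → N i j ≡ true → InWindow a m (toℕ i)) → card N < m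
  rowConfined-card< a confined =
    confined-card< a m N⊆C (RowUnique-⊆ N⊆M (proj₁ (isMatching⇒rowUnique matching)))
      (RowConsecutive-⊆ N⊆M (proj₁ (isConsecutive⇒rowConsecutive consecutive)))
      confined short


  colConfined-card< : ∀ b → (∀ {i j} → N i j ≡ true → InWindow b m (toℕ j)) → card N < m
  colConfined-card< b confined = subst (_< m) (card-ᵀ N)
    (confined-card< b m (⊆E-ᵀ N⊆C) (RowUnique-⊆ (⊆E-ᵀ N⊆M) (proj₂ (isMatching⇒rowUnique matching)))
      (RowConsecutive-⊆ (⊆E-ᵀ N⊆M) (proj₂ (isConsecutive⇒rowConsecutive consecutive)))
      confined (λ t → short _ ∘ isRunOf-ᵀ))

rowOrColConfined-card≤ : ∀ {n} {C M N : EdgeSet n} → IsMatching M → IsConsecutive M → N ⊆E M → N ⊆E C →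
  ∀ {m} → (∀ t → IsRunOf C t → r t < suc m) → ∀ a b →
  (∀ {i j} → N i j ≡ true → InWindow a (suc m) (toℕ i) ⊎ InWindow b (suc m) (toℕ j)) →
  card N ≤ m + m
rowOrColConfined-card≤ {n} {C} {M} {N} matching consecutive N⊆M N⊆C {m} short a b confined = begin
  card N           ≡⟨ card-split N inRows ⟩
  card X + card Y  ≤⟨ +-mono-≤ (s≤s⁻¹ X<) (s≤s⁻¹ Y<) ⟩
  m + m            ∎
  where
  open ≤-Reasoning
  inRows X Y : EdgeSet n
  inRows i _ = ⌊ inWindow? a (suc m) (toℕ i) ⌋
  X i j = N i j ∧ inRows i j
  Y i j = N i j ∧ not (inRows i j)
  X⊆N : X ⊆E N
  X⊆N i j = ∧-conicalˡ (N i j) (inRows i j)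
  Y⊆N : Y ⊆E N
  Y⊆N i j = ∧-conicalˡ (N i j) (not (inRows i j))
  X< : card X < suc m
  X< = rowConfined-card< matching consecutive (⊆E-trans X⊆N N⊆M) (⊆E-trans X⊆N N⊆C) short
         a (λ {i} {j} e → toWitness (T-≡ .from (∧-conicalʳ (N i j) _ e)))
  Y-cols : ∀ {i j} → Y i j ≡ true → InWindow b (suc m) (toℕ j)
  Y-cols {i} {j} e with confined (Y⊆N i j e)
  ... | inj₁ in-row = ⊥-elim (toWitnessFalse (T-≡ .from (∧-conicalʳ (N i j) _ e)) in-row)
  ... | inj₂ in-col = in-col
  Y< : card Y < suc m
  Y< = colConfined-card< matching consecutive (⊆E-trans Y⊆N N⊆M) (⊆E-trans Y⊆N N⊆C) short b Y-cols

greedy-snapshot : ∀ {n k} {E : EdgeSet n} earlier s later → GreedyRun k E (earlier ++ s ∷ later) →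
  Σ (EdgeSet n) λ C → IsStreak C s × (∀ t → IsStreak C t → r t ≤ r s) ×
    (∀ {i j} → E i j ≡ true → overlapsSomeᵇ earlier i j ≡ false → C i j ≡ true)
greedy-snapshot []       s later (step s-streak s-longest _ _) = _ , s-streak , s-longest , λ Eij _ → Eij
greedy-snapshot (e ∷ es) s later (step _ _ _ greedy) with greedy-snapshot es s later greedy
... | C , s-streak , s-longest , kept = C , s-streak , s-longest ,
  λ {i} {j} Eij disjoint →
    kept (cong₂ (λ x y → x ∧ not y) Eij (∨-conicalˡ _ _ disjoint)) (∨-conicalʳ _ _ disjoint)

∣m-n∣≤1⇒m≤1+n×n≤1+m : ∀ x y → ∣ x - y ∣ ≤ 1 → x ≤ suc y × y ≤ suc x
∣m-n∣≤1⇒m≤1+n×n≤1+m zero    y       d≤1 = z≤n , d≤1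
∣m-n∣≤1⇒m≤1+n×n≤1+m (suc x) zero    d≤1 = d≤1 , z≤n
∣m-n∣≤1⇒m≤1+n×n≤1+m (suc x) (suc y) d≤1 =
  let (x≤ , y≤) = ∣m-n∣≤1⇒m≤1+n×n≤1+m x y d≤1 in s≤s x≤ , s≤s y≤

near⇒inWindow : ∀ {x a l m} → ∣ x - (a + l) ∣ ≤ 1 → l < m → InWindow (a ∸ 1) (2 + m) x
near⇒inWindow {x} {zero}  {l} {m} d≤1 l<m =
  z≤n , s≤s (m≤n⇒m≤1+n (≤-trans (proj₁ (∣m-n∣≤1⇒m≤1+n×n≤1+m x l d≤1)) l<m))
near⇒inWindow {x} {suc a} {l} {m} d≤1 l<m with ∣m-n∣≤1⇒m≤1+n×n≤1+m x (suc a + l) d≤1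
... | x≤ , y≤ = ≤-trans (m≤m+n a l) (s≤s⁻¹ y≤) , (begin-strict
  x             ≤⟨ x≤ ⟩
  2 + (a + l)   <⟨ s≤s (s≤s (+-monoʳ-< a l<m)) ⟩
  2 + (a + m)   ≡⟨ sym (trans (+-suc a (suc m)) (cong suc (+-suc a m))) ⟩
  a + (2 + m)   ∎)
  where open ≤-Reasoning

overlapsRun⇒inWindow : ∀ {n} s (i j : Fin n) → overlapsRunᵇ s i j ≡ true →
  InWindow (p s ∸ 1) (2 + r s) (toℕ i) ⊎ InWindow (q s ∸ 1) (2 + r s) (toℕ j)
overlapsRun⇒inWindow s i j overlaps
  with applyUpTo⁻ id (any⁻ _ (List.upTo (r s)) (T-≡ .from overlaps))
... | l , l<r , near with T-∨ {∣ toℕ i - (p s + l) ∣ ≤ᵇ 1} {∣ toℕ j - (q s + l) ∣ ≤ᵇ 1} .to near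
...   | inj₁ near-i = inj₁ (near⇒inWindow (≤ᵇ⇒≤ _ 1 near-i) l<r)
...   | inj₂ near-j = inj₂ (near⇒inWindow (≤ᵇ⇒≤ _ 1 near-j) l<r)

newlyOverlapped⇒ : ∀ {n} (OPT : EdgeSet n) earlier s {i j} → newlyOverlapped OPT earlier s i j ≡ true →
  OPT i j ≡ true × overlapsRunᵇ s i j ≡ true × overlapsSomeᵇ earlier i j ≡ false
newlyOverlapped⇒ OPT earlier s {i} {j} new =
  ∧-conicalˡ (OPT i j) _ new , ∧-conicalˡ (overlapsRunᵇ s i j) _ rest ,
  trans (sym (not-involutive _)) (cong not (∧-conicalʳ (overlapsRunᵇ s i j) _ rest))
  where
  rest : overlapsRunᵇ s i j ∧ not (overlapsSomeᵇ earlier i j) ≡ true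
  rest = ∧-conicalʳ (OPT i j) _ new

lemma1 : (n : ℕ) (E : EdgeSet n) (k : ℕ) → 1 ≤ k →
    (OPT : EdgeSet n) → IsMaxConsecutiveMatching E OPT →
    (ss : List Run) → GreedyRun k E ss →
    (earlier : List Run) (s : Run) (later : List Run) → ss ≡ earlier ++ (s ∷ later) →
    card (newlyOverlapped OPT earlier s) ≤ 2 * r s + 2
lemma1 n E k _ OPT ((OPT⊆E , matching , consecutive) , _) ss greedy earlier s later refl
  with greedy-snapshot earlier s later greedy
... | C , _ , s-longest , kept = begin
  card o                 ≤⟨ rowOrColConfined-card≤ matching consecutive o⊆OPT o⊆C runs-short
                              (p s ∸ 1) (q s ∸ 1) near ⟩
  suc (r s) + suc (r s)  ≡⟨ twice-suc (r s) ⟩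
  2 * r s + 2            ∎
  where
  open ≤-Reasoning
  twice-suc : ∀ x → suc x + suc x ≡ 2 * x + 2
  twice-suc = solve-∀
  o : EdgeSet n
  o = newlyOverlapped OPT earlier s
  o⊆OPT : o ⊆E OPT
  o⊆OPT i j new = proj₁ (newlyOverlapped⇒ OPT earlier s new)
  o⊆C : o ⊆E C
  o⊆C i j new =
    let (OPTij , _ , disjoint) = newlyOverlapped⇒ OPT earlier s new in kept (OPT⊆E i j OPTij) disjoint
  near : ∀ {i j} → o i j ≡ true →
    InWindow (p s ∸ 1) (2 + r s) (toℕ i) ⊎ InWindow (q s ∸ 1) (2 + r s) (toℕ j)
  near {i} {j} new = overlapsRun⇒inWindow s i j (proj₁ (proj₂ (newlyOverlapped⇒ OPT earlier s new)))
  runs-short : ∀ t → IsRunOf C t → r t < 2 + r s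
  runs-short t t-run = s≤s (m≤n⇒m≤1+n (run-≤-longest-streak s-longest t t-run))
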